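{- For every positive integer $k$, every graph $G$ on $n$ vertices that does not contain $R_k$ as an induced subgraph contains a homogeneous set (a clique or an independent set) of size at least $n^{1/(2k)}/4$.
   Context: $R_k$ (the universal threshold graph of order $k$) has vertices $a_1,\dots,a_k,b_1,\dots,b_k$, edges $a_ib_j$ for all $1\le i\le j\le k$, the vertices $a_1,\dots,a_k$ forming a clique and $b_1,\dots,b_k$ an independent set, and no other edges. -}

module Defs where

open import Data.Nat using (ℕ; _≤_; _*_; _^_)
open import Data.Fin using (Fin)
import Data.Fin as Fin
open import Data.Bool using (Bool; true; false; not)
open import Data.Sum using (_⊎_; inj₁; inj₂)
open import Data.Product using (Σ; _×_; ∃)
open import Relation.Nullary using (¬_)
open import Relation.Nullary.Decidable using (⌊_⌋)
open import Relation.Binary.PropositionalEquality using (_≡_; _≢_)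
open import Function.Definitions using (Injective)

record Graph (n : ℕ) : Set where
  field
    adj     : Fin n → Fin n → Bool
    sym     : ∀ u v → adj u v ≡ adj v u
    irrefl  : ∀ u → adj u u ≡ false
open Graph public

-- Vertices of R_k: inj₁ i = a_i, inj₂ j = b_j  (indices 0..k-1).
RVertex : ℕ → Set
RVertex k = Fin k ⊎ Fin k

RAdj : (k : ℕ) → RVertex k → RVertex k → Bool
RAdj k (inj₁ i) (inj₁ j) = not ⌊ i Fin.≟ j ⌋
RAdj k (inj₁ i) (inj₂ j) = ⌊ i Fin.≤? j ⌋
RAdj k (inj₂ i) (inj₁ j) = ⌊ j Fin.≤? i ⌋
RAdj k (inj₂ i) (inj₂ j) = false

ContainsInducedRk : ∀ {n} → Graph n → ℕ → Set
ContainsInducedRk {n} G k =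
  Σ (RVertex k → Fin n) λ f →
    Injective _≡_ _≡_ f ×
    (∀ u v → u ≢ v → adj G (f u) (f v) ≡ RAdj k u v)

IsClique : ∀ {n s} → Graph n → (Fin s → Fin n) → Set
IsClique G g = ∀ i j → i ≢ j → adj G (g i) (g j) ≡ true

IsIndependent : ∀ {n s} → Graph n → (Fin s → Fin n) → Set
IsIndependent G g = ∀ i j → i ≢ j → adj G (g i) (g j) ≡ false

HomogeneousSet : ∀ {n} → Graph n → ℕ → Set
HomogeneousSet {n} G s =
  Σ (Fin s → Fin n) λ g → Injective _≡_ _≡_ g × (IsClique G g ⊎ IsIndependent G g)

-- R_k is the threshold graph obtained from the empty graph by alternately adding
-- an isolated and a dominating vertex (b_{k-1}, a_{k-1}, ..., b_0, a_0).  Let F be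
-- a threshold graph whose last vertex is dominating (isolated) and v any vertex of
-- G.  The neighbours (non-neighbours) of v avoid F minus its last vertex, while the
-- non-neighbours (neighbours) still avoid F and v enlarges their independent sets
-- (cliques).  Induction on |F| gives n ≤ (2 t)^|F|, with t the combined size of a
-- clique and an independent set; for F = R_k, |F| = 2 k and t ≤ 2 s.
module Submission where

open import Defs
open import Data.Nat using (ℕ; _≤_; _*_; _^_)
open import Data.Product using (Σ; _×_)
open import Relation.Nullary using (¬_)

open import Data.Bool using (Bool; true; false; not)
import Data.Bool as Bool
open import Data.Empty using (⊥-elim)
open import Data.Fin using (Fin; zero; suc)
import Data.Fin as Fin
open import Data.List using (List; []; _∷_; length; filter; lookup; allFin)
open import Data.List.Properties using (length-tabulate; length-filter)
open import Data.List.Membership.Propositional using (_∈_)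
open import Data.List.Membership.Propositional.Properties using (∈-filter⁻; ∈-lookup)
open import Data.List.Relation.Binary.Subset.Propositional using (_⊆_)
open import Data.List.Relation.Binary.Subset.Propositional.Properties
  using (⊆-trans; xs⊆x∷xs; ∷⁺ʳ; filter-⊆)
open import Data.List.Relation.Unary.All as All using (All; []; _∷_)
open import Data.List.Relation.Unary.AllPairs using (AllPairs; []; _∷_)
open import Data.List.Relation.Unary.Any using (here; there)
open import Data.List.Relation.Unary.Unique.Propositional using (Unique)
open import Data.List.Relation.Unary.Unique.Propositional.Properties using (allFin⁺; filter⁺)
open import Data.Nat using (zero; suc; _+_; z≤n; s≤s; s≤s⁻¹)
open import Data.Nat.Properties
  using ( ≤-refl; ≤-trans; ≤-reflexive; ≤-total; n≤1+n; +-suc; +-mono-≤; *-mono-≤; *-monoʳ-≤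
        ; m^n>0; ^-monoˡ-≤; module ≤-Reasoning)
open import Data.Nat.Solver using (module +-*-Solver)
open import Data.Product using (_,_; proj₁; proj₂; ∃)
open import Data.Sum using (_⊎_; inj₁; inj₂)
import Data.Sum as Sum
open import Data.Sum.Properties using (≡-dec)
open import Function using (_∘_; id; mk⇔)
open import Function.Definitions using (Injective)
open import Relation.Binary.Definitions using (DecidableEquality; Symmetric)
open import Relation.Binary.PropositionalEquality using (_≡_; _≢_; refl; trans; cong; subst)
import Relation.Binary.PropositionalEquality as ≡
open import Relation.Nullary using (yes; no)
open import Relation.Nullary.Decidable using (⌊_⌋; isYes≗does; does-⇔; ⌊⌋-map′)

distinct⇒injective : ∀ {A B : Set} {f : A → B} → DecidableEquality A →
                     (∀ {x y} → x ≢ y → f x ≢ f y) → Injective _≡_ _≡_ f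
distinct⇒injective _≟_ f-distinct {x} {y} fx≡fy with x ≟ y
... | yes x≡y = x≡y
... | no x≢y  = ⊥-elim (f-distinct x≢y fx≡fy)

lookup-AllPairs : ∀ {A : Set} {R : A → A → Set} → Symmetric R → ∀ {xs} → AllPairs R xs →
                  ∀ i j → i ≢ j → R (lookup xs i) (lookup xs j)
lookup-AllPairs R-sym (_ ∷ _)     zero    zero    i≢j = ⊥-elim (i≢j refl)
lookup-AllPairs R-sym (x~xs ∷ _)  zero    (suc j) _   = All.lookup x~xs (∈-lookup j)
lookup-AllPairs R-sym (x~xs ∷ _)  (suc i) zero    _   = R-sym (All.lookup x~xs (∈-lookup i))
lookup-AllPairs R-sym (_ ∷ pairs) (suc i) (suc j) i≢j =
  lookup-AllPairs R-sym pairs i j (i≢j ∘ cong suc)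

length-filter-split : ∀ {A : Set} (p : A → Bool) (b : Bool) xs →
                      length (filter (λ x → p x Bool.≟ b) xs) + length (filter (λ x → p x Bool.≟ not b) xs)
                      ≡ length xs
length-filter-split p b [] = refl
length-filter-split p true (x ∷ xs) with p x
... | true  = cong suc (length-filter-split p true xs)
... | false = trans (+-suc _ _) (cong suc (length-filter-split p true xs))
length-filter-split p false (x ∷ xs) with p x
... | true  = trans (+-suc _ _) (cong suc (length-filter-split p false xs))
... | false = cong suc (length-filter-split p false xs)

longer : ∀ {A : Set} (P : List A → Set) {xs ys} → P xs → P ys →
         ∃ λ zs → P zs × length xs ≤ length zs × length ys ≤ length zs
longer P {xs} {ys} pxs pys with ≤-total (length xs) (length ys)
... | inj₁ xs≤ys = ys , pys , xs≤ys , ≤-refl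
... | inj₂ ys≤xs = xs , pxs , ≤-refl , ys≤xs

split-bound : ∀ j {t₁ t₂ t x y} → t₁ ≤ t → suc t₂ ≤ t →
              x ≤ (2 * t₁) ^ j → y ≤ (2 * t₂) ^ suc j → suc (x + y) ≤ (2 * t) ^ suc j
split-bound j {t₁} {t₂} {suc t} {x} {y} t₁≤ (s≤s t₂≤t) x≤ y≤ = begin
  suc (x + y)          ≤⟨ s≤s (+-mono-≤ x≤P y≤tP) ⟩
  suc P + 2 * t * P    ≤⟨ +-mono-≤ (+-mono-≤ (m^n>0 (2 * suc t) j) ≤-refl) ≤-refl ⟩
  P + P + 2 * t * P    ≡⟨ solve 2 (λ t P → P :+ P :+ con 2 :* t :* P := con 2 :* (con 1 :+ t) :* P)
                                refl t P ⟩
  2 * suc t * P        ∎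
  where
  open ≤-Reasoning
  open +-*-Solver
  P : ℕ
  P = (2 * suc t) ^ j
  x≤P : x ≤ P
  x≤P = ≤-trans x≤ (^-monoˡ-≤ j (*-monoʳ-≤ 2 t₁≤))
  y≤tP : y ≤ 2 * t * P
  y≤tP = ≤-trans y≤ (*-mono-≤ (*-monoʳ-≤ 2 t₂≤t)
                              (^-monoˡ-≤ j (*-monoʳ-≤ 2 (≤-trans t₂≤t (n≤1+n t)))))

double-sum≤ : ∀ {a b c} → a ≤ c → b ≤ c → 2 * (a + b) ≤ 4 * c
double-sum≤ {a} {b} {c} a≤c b≤c = begin
  2 * (a + b) ≤⟨ *-monoʳ-≤ 2 (+-mono-≤ a≤c b≤c) ⟩
  2 * (c + c) ≡⟨ solve 1 (λ c → con 2 :* (c :+ c) := con 4 :* c) refl c ⟩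
  4 * c       ∎
  where
  open ≤-Reasoning
  open +-*-Solver

alternating : ℕ → List Bool
alternating zero    = []
alternating (suc k) = true ∷ false ∷ alternating k

length-alternating : ∀ k → length (alternating k) ≡ 2 * k
length-alternating zero    = refl
length-alternating (suc k) =
  trans (cong (2 +_) (length-alternating k)) (≡.sym (+-suc (suc k) (k + 0)))

shift : ∀ {k} → RVertex k → RVertex (suc k)
shift = Sum.map suc suc

⌊suc≤?suc⌋ : ∀ {k} (i j : Fin k) → ⌊ suc i Fin.≤? suc j ⌋ ≡ ⌊ i Fin.≤? j ⌋
⌊suc≤?suc⌋ i j =
  trans (isYes≗does _)
        (trans (does-⇔ (mk⇔ s≤s⁻¹ s≤s) (suc i Fin.≤? suc j) (i Fin.≤? j)) (≡.sym (isYes≗does _)))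

RAdj-shift : ∀ {k} u w → RAdj (suc k) (shift u) (shift w) ≡ RAdj k u w
RAdj-shift (inj₁ i) (inj₁ j) = cong not (⌊⌋-map′ _ _ (i Fin.≟ j))
RAdj-shift (inj₁ i) (inj₂ j) = ⌊suc≤?suc⌋ i j
RAdj-shift (inj₂ i) (inj₁ j) = ⌊suc≤?suc⌋ j i
RAdj-shift (inj₂ i) (inj₂ j) = refl

module _ {n : ℕ} (G : Graph n) where

  infix 4 _~[_]_

  _~[_]_ : Fin n → Bool → Fin n → Set
  x ~[ c ] y = x ≢ y × adj G x y ≡ c

  ~-sym : ∀ {c} → Symmetric (_~[ c ]_)
  ~-sym (x≢y , xy≡c) = x≢y ∘ ≡.sym , trans (sym G _ _) xy≡c

  -- Each vertex of xs is joined to all later ones (d = true) or to none (d = false), so xs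
  -- induces the threshold graph built by adding its vertices from last to first.
  data Realises : List Bool → List (Fin n) → Set where
    []  : Realises [] []
    _∷_ : ∀ {d ds x xs} → All (x ~[ d ]_) xs → Realises ds xs → Realises (d ∷ ds) (x ∷ xs)

  Occurs : List Bool → List (Fin n) → Set
  Occurs ds S = ∃ λ xs → Realises ds xs × xs ⊆ S

  occurs-mono : ∀ {ds S T} → S ⊆ T → Occurs ds S → Occurs ds T
  occurs-mono S⊆T (xs , xs-realises , xs⊆S) = xs , xs-realises , ⊆-trans xs⊆S S⊆T

  joined : Bool → Fin n → List (Fin n) → List (Fin n)
  joined c v = filter (λ x → adj G v x Bool.≟ c)

  ∈-joined⇒~ : ∀ {c v xs x} → All (v ≢_) xs → x ∈ joined c v xs → v ~[ c ] x
  ∈-joined⇒~ v∉xs x∈ = let x∈xs , vx≡c = ∈-filter⁻ _ x∈ in All.lookup v∉xs x∈xs , vx≡c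

  occurs-∷ : ∀ {d ds v xs} → All (v ≢_) xs → Occurs ds (joined d v xs) → Occurs (d ∷ ds) (v ∷ xs)
  occurs-∷ {v = v} v∉xs (ys , ys-realises , ys⊆) =
    v ∷ ys , All.tabulate (∈-joined⇒~ v∉xs ∘ ys⊆) ∷ ys-realises ,
    ∷⁺ʳ v (⊆-trans ys⊆ (filter-⊆ _ _))

  HomogeneousIn : List (Fin n) → Bool → List (Fin n) → Set
  HomogeneousIn S c xs = AllPairs (_~[ c ]_) xs × xs ⊆ S

  homogeneousIn-mono : ∀ {S T c xs} → S ⊆ T → HomogeneousIn S c xs → HomogeneousIn T c xs
  homogeneousIn-mono S⊆T (xs-pairs , xs⊆S) = xs-pairs , ⊆-trans xs⊆S S⊆T

  record HomogeneousSets (S : List (Fin n)) : Set where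
    field
      set   : Bool → List (Fin n)
      valid : ∀ c → HomogeneousIn S c (set c)

    size : ℕ
    size = length (set true) + length (set false)

  open HomogeneousSets

  empty : HomogeneousSets []
  empty = record { set = λ _ → [] ; valid = λ _ → [] , λ () }

  widen : ∀ {S T} → S ⊆ T → HomogeneousSets S → HomogeneousSets T
  widen S⊆T H = record { set = set H ; valid = homogeneousIn-mono S⊆T ∘ valid H }

  merge : ∀ {S} (H₁ H₂ : HomogeneousSets S) →
          Σ (HomogeneousSets S) λ H → size H₁ ≤ size H × size H₂ ≤ size H
  merge {S} H₁ H₂ = record { set = proj₁ ∘ best ; valid = proj₁ ∘ proj₂ ∘ best }
                  , +-mono-≤ (first true) (first false) , +-mono-≤ (second true) (second false)
    where
    best : ∀ c → ∃ λ xs → HomogeneousIn S c xs × length (set H₁ c) ≤ length xs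
                                               × length (set H₂ c) ≤ length xs
    best c = longer (HomogeneousIn S c) (valid H₁ c) (valid H₂ c)
    first : ∀ c → length (set H₁ c) ≤ length (proj₁ (best c))
    first c = proj₁ (proj₂ (proj₂ (best c)))
    second : ∀ c → length (set H₂ c) ≤ length (proj₁ (best c))
    second c = proj₂ (proj₂ (proj₂ (best c)))

  insertAt : Bool → Fin n → (Bool → List (Fin n)) → Bool → List (Fin n)
  insertAt true  v L true  = v ∷ L true
  insertAt false v L false = v ∷ L false
  insertAt _     _ L c     = L c

  size-insertAt : ∀ c v L → length (insertAt c v L true) + length (insertAt c v L false)
                            ≡ suc (length (L true) + length (L false))
  size-insertAt true  v L = refl
  size-insertAt false v L = +-suc _ _

  insert : ∀ {S} (H : HomogeneousSets S) c v → All (v ~[ c ]_) (set H c) →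
           Σ (HomogeneousSets (v ∷ S)) λ H′ → size H′ ≡ suc (size H)
  insert {S} H c v v~ =
    record { set = insertAt c v (set H) ; valid = valid′ c v~ } , size-insertAt c v (set H)
    where
    kept : ∀ c → HomogeneousIn (v ∷ S) c (set H c)
    kept c = homogeneousIn-mono (xs⊆x∷xs S v) (valid H c)
    extended : ∀ {c} → All (v ~[ c ]_) (set H c) → HomogeneousIn (v ∷ S) c (v ∷ set H c)
    extended {c} v~ = let xs-pairs , xs⊆S = valid H c in v~ ∷ xs-pairs , ∷⁺ʳ v xs⊆S
    valid′ : ∀ c → All (v ~[ c ]_) (set H c) →
             ∀ c′ → HomogeneousIn (v ∷ S) c′ (insertAt c v (set H) c′)
    valid′ true  v~ true  = extended v~
    valid′ true  _  false = kept false
    valid′ false _  true  = kept true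
    valid′ false v~ false = extended v~

  WithHomogeneousBound : ℕ → List (Fin n) → Set
  WithHomogeneousBound j S = Σ (HomogeneousSets S) λ H → length S ≤ (2 * size H) ^ j

  split-step : ∀ {j d v xs} → All (v ≢_) xs →
               WithHomogeneousBound j (joined d v xs) →
               WithHomogeneousBound (suc j) (joined (not d) v xs) →
               WithHomogeneousBound (suc j) (v ∷ xs)
  split-step {j} {d} {v} {xs} v∉xs (H₁ , bound₁) (H₂ , bound₂)
    with H₂′ , size-H₂′ ← insert (widen (filter-⊆ _ xs) H₂) (not d) v
                                 (All.tabulate (∈-joined⇒~ v∉xs ∘ proj₂ (valid H₂ (not d))))
    with H , H₁≤H , H₂′≤H ← merge (widen (⊆-trans (filter-⊆ _ xs) (xs⊆x∷xs xs v)) H₁) H₂′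
    = H , (begin
      suc (length xs)
        ≡⟨ cong suc (≡.sym (length-filter-split (adj G v) d xs)) ⟩
      suc (length (joined d v xs) + length (joined (not d) v xs))
        ≤⟨ split-bound j H₁≤H (subst (_≤ size H) size-H₂′ H₂′≤H) bound₁ bound₂ ⟩
      (2 * size H) ^ suc j ∎)
    where open ≤-Reasoning

  threshold-free⇒homogeneous : ∀ ds S → Unique S → ¬ Occurs ds S →
                               WithHomogeneousBound (length ds) S
  threshold-free⇒homogeneous ds S = go (length S) ds S ≤-refl
    where
    go : ∀ m ds S → length S ≤ m → Unique S → ¬ Occurs ds S → WithHomogeneousBound (length ds) S
    go _       []       _        _            _                 ds-free = ⊥-elim (ds-free ([] , [] , λ ()))
    go _       (d ∷ ds) []       _            _                 _       = empty , z≤n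
    go (suc m) (d ∷ ds) (v ∷ xs) (s≤s |xs|≤m) (v∉xs ∷ unique) ds-free =
      split-step {length ds} {d} v∉xs
        (go m ds (joined d v xs) (shorter d) (filter⁺ _ unique) (ds-free ∘ occurs-∷ v∉xs))
        (go m (d ∷ ds) (joined (not d) v xs) (shorter (not d)) (filter⁺ _ unique)
            (ds-free ∘ occurs-mono (⊆-trans (filter-⊆ _ xs) (xs⊆x∷xs xs v))))
      where
      shorter : ∀ c → length (joined c v xs) ≤ m
      shorter c = ≤-trans (length-filter _ xs) |xs|≤m

  Embeds : ℕ → List (Fin n) → Set
  Embeds k xs = Σ (RVertex k → Fin n) λ f →
    (∀ u w → u ≢ w → f u ~[ RAdj k u w ] f w) × (∀ u → f u ∈ xs)

  embeds-∷∷ : ∀ {k a b ys} → a ~[ true ] b → All (a ~[ true ]_) ys → All (b ~[ false ]_) ys →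
              Embeds k ys → Embeds (suc k) (a ∷ b ∷ ys)
  embeds-∷∷ {k} {a} {b} {ys} a~b a~ys b~ys (f , f~ , f∈) = g , g~ , g∈
    where
    a~f : ∀ u → a ~[ true ] f u
    a~f u = All.lookup a~ys (f∈ u)
    b~f : ∀ u → b ~[ false ] f u
    b~f u = All.lookup b~ys (f∈ u)

    g : RVertex (suc k) → Fin n
    g (inj₁ zero)    = a
    g (inj₂ zero)    = b
    g (inj₁ (suc i)) = f (inj₁ i)
    g (inj₂ (suc j)) = f (inj₂ j)

    shifted : ∀ u w → shift u ≢ shift w → f u ~[ RAdj (suc k) (shift u) (shift w) ] f w
    shifted u w u≢w = subst (f u ~[_] f w) (≡.sym (RAdj-shift u w)) (f~ u w (u≢w ∘ cong shift))

    g~ : ∀ u w → u ≢ w → g u ~[ RAdj (suc k) u w ] g w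
    g~ (inj₁ zero)    (inj₁ zero)    u≢w = ⊥-elim (u≢w refl)
    g~ (inj₁ zero)    (inj₂ zero)    _   = a~b
    g~ (inj₁ zero)    (inj₁ (suc j)) _   = a~f _
    g~ (inj₁ zero)    (inj₂ (suc j)) _   = a~f _
    g~ (inj₂ zero)    (inj₁ zero)    _   = ~-sym a~b
    g~ (inj₂ zero)    (inj₂ zero)    u≢w = ⊥-elim (u≢w refl)
    g~ (inj₂ zero)    (inj₁ (suc j)) _   = b~f _
    g~ (inj₂ zero)    (inj₂ (suc j)) _   = b~f _
    g~ (inj₁ (suc i)) (inj₁ zero)    _   = ~-sym (a~f _)
    g~ (inj₁ (suc i)) (inj₂ zero)    _   = ~-sym (b~f _)
    g~ (inj₂ (suc i)) (inj₁ zero)    _   = ~-sym (a~f _)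
    g~ (inj₂ (suc i)) (inj₂ zero)    _   = ~-sym (b~f _)
    g~ (inj₁ (suc i)) (inj₁ (suc j)) u≢w = shifted (inj₁ i) (inj₁ j) u≢w
    g~ (inj₁ (suc i)) (inj₂ (suc j)) u≢w = shifted (inj₁ i) (inj₂ j) u≢w
    g~ (inj₂ (suc i)) (inj₁ (suc j)) u≢w = shifted (inj₂ i) (inj₁ j) u≢w
    g~ (inj₂ (suc i)) (inj₂ (suc j)) u≢w = shifted (inj₂ i) (inj₂ j) u≢w

    g∈ : ∀ u → g u ∈ a ∷ b ∷ ys
    g∈ (inj₁ zero)    = here refl
    g∈ (inj₂ zero)    = there (here refl)
    g∈ (inj₁ (suc i)) = there (there (f∈ (inj₁ i)))
    g∈ (inj₂ (suc j)) = there (there (f∈ (inj₂ j)))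

  realises-alternating⇒embeds : ∀ k {xs} → Realises (alternating k) xs → Embeds k xs
  realises-alternating⇒embeds zero    [] =
    Sum.[ (λ ()) , (λ ()) ] , (λ { (inj₁ ()) ; (inj₂ ()) }) , λ { (inj₁ ()) ; (inj₂ ()) }
  realises-alternating⇒embeds (suc k) ((a~b ∷ a~ys) ∷ b~ys ∷ ys-realises) =
    embeds-∷∷ a~b a~ys b~ys (realises-alternating⇒embeds k ys-realises)

  embeds⇒containsInducedRk : ∀ {k xs} → Embeds k xs → ContainsInducedRk G k
  embeds⇒containsInducedRk (f , f~ , _) =
    f , distinct⇒injective (≡-dec Fin._≟_ Fin._≟_) (λ {u} {w} u≢w → proj₁ (f~ u w u≢w)) ,
    λ u w u≢w → proj₂ (f~ u w u≢w)

  occurs-alternating⇒containsInducedRk : ∀ {k S} → Occurs (alternating k) S →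
                                         ContainsInducedRk G k
  occurs-alternating⇒containsInducedRk {k} (_ , xs-realises , _) =
    embeds⇒containsInducedRk (realises-alternating⇒embeds k xs-realises)

  homogeneousSet : ∀ c {xs} → AllPairs (_~[ c ]_) xs → HomogeneousSet G (length xs)
  homogeneousSet c {xs} xs-pairs =
    lookup xs , distinct⇒injective Fin._≟_ (λ {i} {j} i≢j → proj₁ (lookup~ i j i≢j)) ,
    coloured c (λ i j i≢j → proj₂ (lookup~ i j i≢j))
    where
    lookup~ : ∀ i j → i ≢ j → lookup xs i ~[ c ] lookup xs j
    lookup~ = lookup-AllPairs ~-sym xs-pairs
    coloured : ∀ c → (∀ i j → i ≢ j → adj G (lookup xs i) (lookup xs j) ≡ c) →
               IsClique G (lookup xs) ⊎ IsIndependent G (lookup xs)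
    coloured true  = inj₁
    coloured false = inj₂

  largest-colour : ∀ {S} (H : HomogeneousSets S) → ∃ λ c → 2 * size H ≤ 4 * length (set H c)
  largest-colour H with ≤-total (length (set H true)) (length (set H false))
  ... | inj₁ t≤f = false , double-sum≤ t≤f ≤-refl
  ... | inj₂ f≤t = true  , double-sum≤ ≤-refl f≤t

corollary1p11 : (k : ℕ) → 1 ≤ k → (n : ℕ) (G : Graph n) → ¬ ContainsInducedRk G k →
    Σ ℕ (λ s → HomogeneousSet G s × n ≤ (4 * s) ^ (2 * k))
corollary1p11 k _ n G Rk-free
  with H , n≤ ← threshold-free⇒homogeneous G (alternating k) (allFin n) (allFin⁺ n)
                                           (Rk-free ∘ occurs-alternating⇒containsInducedRk G)
  with c , 2size≤ ← largest-colour G H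
  = length (set H c) , homogeneousSet G c (proj₁ (valid H c)) , (begin
    n                                     ≡⟨ ≡.sym (length-tabulate id) ⟩
    length (allFin n)                     ≤⟨ n≤ ⟩
    (2 * size H) ^ length (alternating k) ≡⟨ cong ((2 * size H) ^_) (length-alternating k) ⟩
    (2 * size H) ^ (2 * k)                ≤⟨ ^-monoˡ-≤ (2 * k) 2size≤ ⟩
    (4 * length (set H c)) ^ (2 * k)      ∎)
  where
  open HomogeneousSets
  open ≤-Reasoning
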